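{- Let $V$ be a finite set with $n=|V|$, $d$ a nonnegative integer, and $f:2^V\to\{0,1,\dots,d\}$ a posimodular function with $f(\emptyset)=0$, such that every maximal maximizer $X^*$ of $f$ satisfies $|X^*|=n-d$ and $f(X^*)=d$. Then: (i) for any maximizer $S$ of $f$ there exists a maximizer $S'$ of $f$ with $S'\cap S=\emptyset$ and $|S'|=d$; (ii) if $S_1,S_2$ are maximizers of $f$ with $S_1\cap S_2=\emptyset$, then there exist maximizers $X_1,X_2$ of $f$ with $|X_1|=|X_2|=d$ and $X_i\subseteq S_i$ for $i=1,2$, and moreover every subset $Y\subseteq V$ with $X_1\subseteq Y\subseteq V\setminus X_2$ or $X_2\subseteq Y\subseteq V\setminus X_1$ is a maximizer of $f$.
   Context: A set function $f:2^V\to\mathbb{R}$ is posimodular if $f(X)+f(Y)\ge f(X\setminus Y)+f(Y\setminus X)$ for all $X,Y\subseteq V$. A maximizer of $f$ is a subset $S\subseteq V$ with $f(S)=\max\{f(X)\mid X\subseteq V\}$; it is a maximal maximizer if no proper superset of $S$ is a maximizer of $f$. -}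

module Defs where

open import Data.Nat using (ℕ; _+_; _≤_; _≥_)
open import Data.Fin.Subset using (Subset; _─_; _⊂_)
open import Relation.Binary.PropositionalEquality using (_≡_)
open import Relation.Nullary using (¬_)

Posimodular : ∀ {n} → (Subset n → ℕ) → Set
Posimodular f = ∀ X Y → f X + f Y ≥ f (X ─ Y) + f (Y ─ X)

IsMaximizer : ∀ {n} → (Subset n → ℕ) → Subset n → Set
IsMaximizer f S = ∀ X → f X ≤ f S

IsMaximalMaximizer : ∀ {n} → (Subset n → ℕ) → Subset n → Set
IsMaximalMaximizer f S = IsMaximizer f S × (∀ T → S ⊂ T → ¬ IsMaximizer f T)
  where open import Data.Product using (_×_)

-- Two consequences of posimodularity drive the proof. First, if A and B are
-- maximizers with A ⊆ Y ⊆ V ∖ B, then posimodularity applied to Y and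
-- (Y ∖ A) ∪ B shows that Y is a maximizer. Second, if X is a maximal maximizer
-- then adding any element strictly decreases f, and posimodularity applied to
-- X + v and W (for v ∈ W ⊆ V ∖ X) gives f(W) > f(W - v); hence f(W) ≥ |W| on
-- V ∖ X. Since |V ∖ X| = d ≥ f everywhere, V ∖ X is a maximizer of size d.
-- Part (i) takes X ⊇ S, part (ii) applies the same to V ∖ S₁ and V ∖ S₂, which
-- are maximizers by the first fact, and the intervals are the first fact again.
module Submission where

open import Defs
open import Data.Nat using (ℕ; _≤_; _∸_)
open import Data.Fin.Subset using (Subset; ⊥; _∩_; _⊆_; ∁; ∣_∣)
open import Data.Product using (_×_; ∃; ∃₂)
open import Data.Sum using (_⊎_)
open import Relation.Binary.PropositionalEquality using (_≡_)

open import Data.Bool using (true; false; _∧_; _∨_; not; b≤b)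
  renaming (_≤_ to _≤ᵇ_)
open import Data.Bool.Properties using (∧-zeroʳ; ∧-identityʳ) renaming (≤-minimum to false≤)
open import Data.Empty using (⊥-elim)
open import Data.Fin using (Fin; zero; suc)
open import Data.Fin.Subset using (_∪_; _─_; _-_; ⁅_⁆; _∈_; _∉_; _⊂_; _⊃_; inside; outside)
open import Data.Fin.Subset.Induction using (⊂-wellFounded; ⊃-wellFounded)
open import Data.Fin.Subset.Properties
  using ( ⊆-refl; ⊆-trans; ⊆-antisym; ⊥⊆; ∉⊥; p⊂q⇒p⊆q; p⊆p∪q; q⊆p∪q; p─q⊆p; p─⊥≡p
        ; p─q─r≡p─q∪r; x∈⁅x⁆; x∈⁅y⁆⇒x≡y; x∈p∩q⁺; x∈p∩q⁻; x∈p⇒p-x⊂p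
        ; x∈∁p⇒x∉p; x∉∁p⇒x∈p; x∉p⇒x∈∁p; p⊆q⇒∁p⊇∁q; ∣∁p∣≡n∸∣p∣; ∣⊥∣≡0; ∩-comm
        ; nonempty?; Empty-unique; anySubset?; _⊂?_ )
open import Data.Nat using (suc; _+_; _<_; _≤?_; z≤n; s≤s)
open import Data.Nat.Properties
  using ( ≤-trans; ≤-total; ≰⇒>; +-suc; +-cancelˡ-≤; +-cancelʳ-≤; +-monoˡ-≤; +-monoʳ-≤
        ; m≤n⇒m∸n≡0; m∸[m∸n]≡n; 0≢1+n; module ≤-Reasoning )
open import Data.Product using (_,_; proj₁)
open import Data.Sum using (inj₁; inj₂)
open import Data.Vec using (lookup; tabulate; _∷_; here; there)
open import Data.Vec.Properties
  using (lookup-zipWith; lookup-map; tabulate∘lookup; tabulate-cong; []=⇒lookup; lookup⇒[]=)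
open import Function using (_∘_)
open import Induction.WellFounded using (Acc; acc)
open import Relation.Nullary using (yes; no; contradiction)
open import Relation.Nullary.Decidable using (_×-dec_)
open import Relation.Binary.PropositionalEquality using (refl; sym; trans; cong; subst; subst₂)

private
  variable
    n : ℕ
    p q r : Subset n
    x : Fin n

-- Subset identities are checked pointwise on Booleans, with inclusions read as _≤ᵇ_
-- so that the cases they exclude are absurd patterns.
Subset-ext : (∀ i → lookup p i ≡ lookup q i) → p ≡ q
Subset-ext {p = p} {q} eq =
  trans (sym (tabulate∘lookup p)) (trans (tabulate-cong eq) (tabulate∘lookup q))

lookup-∪ : ∀ (p q : Subset n) i → lookup (p ∪ q) i ≡ lookup p i ∨ lookup q i
lookup-∪ p q i = lookup-zipWith _∨_ i p q

lookup-─ : ∀ (p q : Subset n) i → lookup (p ─ q) i ≡ lookup p i ∧ not (lookup q i)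
lookup-─ (b ∷ p) (true  ∷ q) zero    = sym (∧-zeroʳ b)
lookup-─ (b ∷ p) (false ∷ q) zero    = sym (∧-identityʳ b)
lookup-─ (_ ∷ p) (_     ∷ q) (suc i) = lookup-─ p q i

⊆⇒lookup-≤ : p ⊆ q → ∀ i → lookup p i ≤ᵇ lookup q i
⊆⇒lookup-≤ {p = p} {q} p⊆q i with lookup p i in eq
... | false = false≤ _
... | true  rewrite []=⇒lookup (p⊆q (lookup⇒[]= i p eq)) = b≤b

⊆∁⇒lookup-≤-not : p ⊆ ∁ q → ∀ i → lookup p i ≤ᵇ not (lookup q i)
⊆∁⇒lookup-≤-not {p = p} {q} p⊆∁q i =
  subst (lookup p i ≤ᵇ_) (lookup-map i not q) (⊆⇒lookup-≤ p⊆∁q i)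

p⊆∁q⇒p─q≡p : p ⊆ ∁ q → p ─ q ≡ p
p⊆∁q⇒p─q≡p {p = p} {q} p⊆∁q = Subset-ext λ i →
  trans (lookup-─ p q i) (pointwise (lookup p i) (lookup q i) (⊆∁⇒lookup-≤-not p⊆∁q i))
  where
  pointwise : ∀ a b → a ≤ᵇ not b → a ∧ not b ≡ a
  pointwise false _     _  = refl
  pointwise true  false _  = refl
  pointwise true  true  ()

p∪r─q≡p : r ⊆ q → q ⊆ ∁ p → (p ∪ r) ─ q ≡ p
p∪r─q≡p {r = r} {q = q} {p = p} r⊆q q⊆∁p = Subset-ext at
  where
  pointwise : ∀ a b c → c ≤ᵇ b → b ≤ᵇ not a → (a ∨ c) ∧ not b ≡ a
  pointwise false false false _  _  = refl
  pointwise true  false false _  _  = refl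
  pointwise _     false true  () _
  pointwise false true  c     _  _  = ∧-zeroʳ c
  pointwise true  true  _     _  ()
  at : ∀ i → lookup ((p ∪ r) ─ q) i ≡ lookup p i
  at i rewrite lookup-─ (p ∪ r) q i | lookup-∪ p r i =
    pointwise (lookup p i) (lookup q i) (lookup r i)
      (⊆⇒lookup-≤ r⊆q i) (⊆∁⇒lookup-≤-not q⊆∁p i)

p─[p─q∪r]≡q : q ⊆ p → p ⊆ ∁ r → p ─ ((p ─ q) ∪ r) ≡ q
p─[p─q∪r]≡q {q = q} {p = p} {r = r} q⊆p p⊆∁r = Subset-ext at
  where
  pointwise : ∀ a b c → b ≤ᵇ a → a ≤ᵇ not c → a ∧ not ((a ∧ not b) ∨ c) ≡ b
  pointwise false false _     _  _  = refl
  pointwise false true  _     () _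
  pointwise true  b     true  _  ()
  pointwise true  false false _  _  = refl
  pointwise true  true  false _  _  = refl
  at : ∀ i → lookup (p ─ ((p ─ q) ∪ r)) i ≡ lookup q i
  at i rewrite lookup-─ p ((p ─ q) ∪ r) i | lookup-∪ (p ─ q) r i | lookup-─ p q i =
    pointwise (lookup p i) (lookup q i) (lookup r i)
      (⊆⇒lookup-≤ q⊆p i) (⊆∁⇒lookup-≤-not p⊆∁r i)

[p─q∪r]─p≡r : p ⊆ ∁ r → ((p ─ q) ∪ r) ─ p ≡ r
[p─q∪r]─p≡r {p = p} {r = r} {q = q} p⊆∁r = Subset-ext at
  where
  pointwise : ∀ a b c → a ≤ᵇ not c → ((a ∧ not b) ∨ c) ∧ not a ≡ c
  pointwise false _     c     _  = ∧-identityʳ c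
  pointwise true  _     true  ()
  pointwise true  false false _  = refl
  pointwise true  true  false _  = refl
  at : ∀ i → lookup (((p ─ q) ∪ r) ─ p) i ≡ lookup r i
  at i rewrite lookup-─ ((p ─ q) ∪ r) p i | lookup-∪ (p ─ q) r i | lookup-─ p q i =
    pointwise (lookup p i) (lookup q i) (lookup r i) (⊆∁⇒lookup-≤-not p⊆∁r i)

p⊆∁q⇒p∩q≡⊥ : p ⊆ ∁ q → p ∩ q ≡ ⊥
p⊆∁q⇒p∩q≡⊥ {p = p} {q} p⊆∁q = ⊆-antisym p∩q⊆⊥ ⊥⊆
  where
  p∩q⊆⊥ : p ∩ q ⊆ ⊥
  p∩q⊆⊥ x∈p∩q with x∈p∩q⁻ p q x∈p∩q
  ... | x∈p , x∈q = contradiction x∈q (x∈∁p⇒x∉p (p⊆∁q x∈p))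

p∩q≡⊥⇒p⊆∁q : p ∩ q ≡ ⊥ → p ⊆ ∁ q
p∩q≡⊥⇒p⊆∁q p∩q≡⊥ x∈p =
  x∉p⇒x∈∁p λ x∈q → ∉⊥ (subst (_ ∈_) p∩q≡⊥ (x∈p∩q⁺ (x∈p , x∈q)))

p∩q≡⊥⇒q⊆∁p : p ∩ q ≡ ⊥ → q ⊆ ∁ p
p∩q≡⊥⇒q⊆∁p {p = p} {q} p∩q≡⊥ = p∩q≡⊥⇒p⊆∁q (trans (∩-comm q p) p∩q≡⊥)

∁∁p⊆p : ∁ (∁ p) ⊆ p
∁∁p⊆p = x∉∁p⇒x∈p ∘ x∈∁p⇒x∉p

x∈p⇒⁅x⁆⊆p : x ∈ p → ⁅ x ⁆ ⊆ p
x∈p⇒⁅x⁆⊆p {x = x} {p = p} x∈p y∈⁅x⁆ = subst (_∈ p) (sym (x∈⁅y⁆⇒x≡y x y∈⁅x⁆)) x∈p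

x∈p⇒∣p∣≡suc∣p-x∣ : x ∈ p → ∣ p ∣ ≡ suc ∣ p - x ∣
x∈p⇒∣p∣≡suc∣p-x∣ {p = inside ∷ p} here = cong (suc ∘ ∣_∣) (sym (p─⊥≡p p))
x∈p⇒∣p∣≡suc∣p-x∣ {p = inside  ∷ p} (there x∈p) = cong suc (x∈p⇒∣p∣≡suc∣p-x∣ x∈p)
x∈p⇒∣p∣≡suc∣p-x∣ {p = outside ∷ p} (there x∈p) = x∈p⇒∣p∣≡suc∣p-x∣ x∈p

∣p∣≡0⇒p≡⊥ : ∣ p ∣ ≡ 0 → p ≡ ⊥
∣p∣≡0⇒p≡⊥ {p = p} ∣p∣≡0 with nonempty? p
... | no  p-empty   = Empty-unique p-empty
... | yes (x , x∈p) = ⊥-elim (0≢1+n (trans (sym ∣p∣≡0) (x∈p⇒∣p∣≡suc∣p-x∣ x∈p)))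

module _ {f : Subset n → ℕ} where

  extend-to-maximal : ∀ {S} → IsMaximizer f S → ∃ λ X → S ⊆ X × IsMaximalMaximizer f X
  extend-to-maximal {S} = go S (⊃-wellFounded S)
    where
    go : ∀ S → Acc _⊃_ S → IsMaximizer f S → ∃ λ X → S ⊆ X × IsMaximalMaximizer f X
    go S (acc larger) S-max with anySubset? (λ T → (S ⊂? T) ×-dec (f S ≤? f T))
    ... | no no-larger-maximizer =
      S , ⊆-refl , S-max , λ T S⊂T T-max → no-larger-maximizer (T , S⊂T , T-max S)
    ... | yes (T , S⊂T , fS≤fT) with go T (larger S⊂T) (λ Y → ≤-trans (S-max Y) fS≤fT)
    ...   | X , T⊆X , X-maximal = X , ⊆-trans (p⊂q⇒p⊆q S⊂T) T⊆X , X-maximal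

  maximal⇒adding-decreases : ∀ {X} → IsMaximalMaximizer f X → ∀ v → v ∉ X → f (X ∪ ⁅ v ⁆) < f X
  maximal⇒adding-decreases {X} (X-max , X-maximal) v v∉X = ≰⇒> λ fX≤ →
    X-maximal (X ∪ ⁅ v ⁆) (p⊆p∪q ⁅ v ⁆ , v , q⊆p∪q X ⁅ v ⁆ (x∈⁅x⁆ v) , v∉X)
      (λ Y → ≤-trans (X-max Y) fX≤)

  module _ (posimodular : Posimodular f) where

    maximizer-from-differences : ∀ {Y Z} → IsMaximizer f (Y ─ Z) → IsMaximizer f (Z ─ Y)
                               → IsMaximizer f Y
    maximizer-from-differences {Y} {Z} Y─Z-max Z─Y-max X =
      ≤-trans (Y─Z-max X)
        (+-cancelʳ-≤ (f (Z ─ Y)) _ _ (≤-trans (posimodular Y Z) (+-monoʳ-≤ (f Y) (Z─Y-max Z))))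

    exchange-maximizer : ∀ {A B Y} → IsMaximizer f A → IsMaximizer f B → A ⊆ Y → Y ⊆ ∁ B
                       → IsMaximizer f Y
    exchange-maximizer {A} {B} {Y} A-max B-max A⊆Y Y⊆∁B =
      maximizer-from-differences {Z = (Y ─ A) ∪ B}
        (subst (IsMaximizer f) (sym (p─[p─q∪r]≡q A⊆Y Y⊆∁B)) A-max)
        (subst (IsMaximizer f) (sym ([p─q∪r]─p≡r Y⊆∁B)) B-max)

    module _ {X} (adding-decreases : ∀ v → v ∉ X → f (X ∪ ⁅ v ⁆) < f X) where

      removing-decreases : ∀ {W v} → W ⊆ ∁ X → v ∈ W → f (W - v) < f W
      removing-decreases {W} {v} W⊆∁X v∈W = +-cancelˡ-≤ (f (X ∪ ⁅ v ⁆)) _ _ (begin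
        f (X ∪ ⁅ v ⁆) + suc (f (W - v)) ≡⟨ +-suc (f (X ∪ ⁅ v ⁆)) (f (W - v)) ⟩
        suc (f (X ∪ ⁅ v ⁆)) + f (W - v) ≤⟨ +-monoˡ-≤ (f (W - v)) (adding-decreases v v∉X) ⟩
        f X + f (W - v)                 ≤⟨ posimodular-at-X+v ⟩
        f (X ∪ ⁅ v ⁆) + f W             ∎)
        where
        open ≤-Reasoning
        v∉X : v ∉ X
        v∉X = x∈∁p⇒x∉p (W⊆∁X v∈W)
        X+v─W≡X : (X ∪ ⁅ v ⁆) ─ W ≡ X
        X+v─W≡X = p∪r─q≡p (x∈p⇒⁅x⁆⊆p v∈W) W⊆∁X
        W─X+v≡W-v : W ─ (X ∪ ⁅ v ⁆) ≡ W - v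
        W─X+v≡W-v = trans (sym (p─q─r≡p─q∪r W X ⁅ v ⁆)) (cong (_- v) (p⊆∁q⇒p─q≡p W⊆∁X))
        posimodular-at-X+v : f X + f (W - v) ≤ f (X ∪ ⁅ v ⁆) + f W
        posimodular-at-X+v = subst₂ (λ P Q → f P + f Q ≤ f (X ∪ ⁅ v ⁆) + f W)
          X+v─W≡X W─X+v≡W-v (posimodular (X ∪ ⁅ v ⁆) W)

      size≤value-outside : ∀ W → W ⊆ ∁ X → ∣ W ∣ ≤ f W
      size≤value-outside W = go W (⊂-wellFounded W)
        where
        go : ∀ W → Acc _⊂_ W → W ⊆ ∁ X → ∣ W ∣ ≤ f W
        go W (acc smaller) W⊆∁X with nonempty? W
        ... | no W-empty rewrite Empty-unique W-empty | ∣⊥∣≡0 n = z≤n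
        ... | yes (v , v∈W) = begin
          ∣ W ∣           ≡⟨ x∈p⇒∣p∣≡suc∣p-x∣ v∈W ⟩
          suc ∣ W - v ∣   ≤⟨ s≤s (go (W - v) (smaller (x∈p⇒p-x⊂p v∈W))
                                     (⊆-trans (p─q⊆p W ⁅ v ⁆) W⊆∁X)) ⟩
          suc (f (W - v)) ≤⟨ removing-decreases W⊆∁X v∈W ⟩
          f W             ∎
          where open ≤-Reasoning

    module MaximalMaximizers {d : ℕ} (f≤d : ∀ X → f X ≤ d) (f⊥≡0 : f ⊥ ≡ 0)
        (maximal-shape : ∀ X → IsMaximalMaximizer f X → ∣ X ∣ ≡ n ∸ d × f X ≡ d) where

      -- n ∸ d truncates: when n ≤ d the maximal maximizer is empty, and f ⊥ ≡ 0 forces d ≡ 0.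
      d≤n : ∀ {X} → IsMaximalMaximizer f X → d ≤ n
      d≤n {X} X-maximal with ≤-total d n | maximal-shape X X-maximal
      ... | inj₁ d≤n | _ = d≤n
      ... | inj₂ n≤d | ∣X∣≡n∸d , fX≡d = subst (_≤ n) d≡0 z≤n
        where
        X≡⊥ : X ≡ ⊥
        X≡⊥ = ∣p∣≡0⇒p≡⊥ (trans ∣X∣≡n∸d (m≤n⇒m∸n≡0 n≤d))
        d≡0 : 0 ≡ d
        d≡0 = trans (sym f⊥≡0) (trans (cong f (sym X≡⊥)) fX≡d)

      ∁-maximal : ∀ {X} → IsMaximalMaximizer f X → IsMaximizer f (∁ X) × ∣ ∁ X ∣ ≡ d
      ∁-maximal {X} X-maximal = ∁X-max , ∣∁X∣≡d
        where
        ∣∁X∣≡d : ∣ ∁ X ∣ ≡ d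
        ∣∁X∣≡d = trans (∣∁p∣≡n∸∣p∣ X)
          (trans (cong (n ∸_) (proj₁ (maximal-shape X X-maximal))) (m∸[m∸n]≡n (d≤n X-maximal)))
        ∁X-max : IsMaximizer f (∁ X)
        ∁X-max Y = ≤-trans (f≤d Y) (subst (_≤ f (∁ X)) ∣∁X∣≡d
          (size≤value-outside (maximal⇒adding-decreases X-maximal) (∁ X) ⊆-refl))

      maximizer-outside : ∀ {S} → IsMaximizer f S
                        → ∃ λ S′ → IsMaximizer f S′ × S′ ⊆ ∁ S × ∣ S′ ∣ ≡ d
      maximizer-outside S-max with extend-to-maximal S-max
      ... | X , S⊆X , X-maximal with ∁-maximal X-maximal
      ...   | ∁X-max , ∣∁X∣≡d = ∁ X , ∁X-max , p⊆q⇒∁p⊇∁q S⊆X , ∣∁X∣≡d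

      maximizer-inside : ∀ {S} → IsMaximizer f (∁ S)
                       → ∃ λ S′ → IsMaximizer f S′ × S′ ⊆ S × ∣ S′ ∣ ≡ d
      maximizer-inside ∁S-max with maximizer-outside ∁S-max
      ... | S′ , S′-max , S′⊆∁∁S , ∣S′∣≡d = S′ , S′-max , ⊆-trans S′⊆∁∁S ∁∁p⊆p , ∣S′∣≡d

      disjoint-maximizer : ∀ S → IsMaximizer f S
                         → ∃ λ S′ → IsMaximizer f S′ × S′ ∩ S ≡ ⊥ × ∣ S′ ∣ ≡ d
      disjoint-maximizer S S-max with maximizer-outside S-max
      ... | S′ , S′-max , S′⊆∁S , ∣S′∣≡d = S′ , S′-max , p⊆∁q⇒p∩q≡⊥ S′⊆∁S , ∣S′∣≡d

      disjoint-maximizers-shrink :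
        ∀ S₁ S₂ → IsMaximizer f S₁ → IsMaximizer f S₂ → S₁ ∩ S₂ ≡ ⊥
        → ∃₂ λ X₁ X₂ → IsMaximizer f X₁ × IsMaximizer f X₂
            × ∣ X₁ ∣ ≡ d × ∣ X₂ ∣ ≡ d × X₁ ⊆ S₁ × X₂ ⊆ S₂
            × (∀ Y → (X₁ ⊆ Y × Y ⊆ ∁ X₂) ⊎ (X₂ ⊆ Y × Y ⊆ ∁ X₁) → IsMaximizer f Y)
      disjoint-maximizers-shrink S₁ S₂ S₁-max S₂-max S₁∩S₂≡⊥
        with maximizer-inside (exchange-maximizer S₂-max S₁-max (p∩q≡⊥⇒q⊆∁p S₁∩S₂≡⊥) ⊆-refl)
           | maximizer-inside (exchange-maximizer S₁-max S₂-max (p∩q≡⊥⇒p⊆∁q S₁∩S₂≡⊥) ⊆-refl)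
      ... | X₁ , X₁-max , X₁⊆S₁ , ∣X₁∣≡d | X₂ , X₂-max , X₂⊆S₂ , ∣X₂∣≡d =
        X₁ , X₂ , X₁-max , X₂-max , ∣X₁∣≡d , ∣X₂∣≡d , X₁⊆S₁ , X₂⊆S₂ , interval
        where
        interval : ∀ Y → (X₁ ⊆ Y × Y ⊆ ∁ X₂) ⊎ (X₂ ⊆ Y × Y ⊆ ∁ X₁) → IsMaximizer f Y
        interval Y (inj₁ (X₁⊆Y , Y⊆∁X₂)) = exchange-maximizer X₁-max X₂-max X₁⊆Y Y⊆∁X₂
        interval Y (inj₂ (X₂⊆Y , Y⊆∁X₁)) = exchange-maximizer X₂-max X₁-max X₂⊆Y Y⊆∁X₁

lemma15 : (n d : ℕ) (f : Subset n → ℕ)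
    → (∀ X → f X ≤ d)
    → Posimodular f
    → f ⊥ ≡ 0
    → (∀ X → IsMaximalMaximizer f X → ∣ X ∣ ≡ n ∸ d × f X ≡ d)
    → (∀ S → IsMaximizer f S
         → ∃ λ S′ → IsMaximizer f S′ × S′ ∩ S ≡ ⊥ × ∣ S′ ∣ ≡ d)
      × (∀ S₁ S₂ → IsMaximizer f S₁ → IsMaximizer f S₂ → S₁ ∩ S₂ ≡ ⊥
         → ∃₂ λ X₁ X₂ → IsMaximizer f X₁ × IsMaximizer f X₂
             × ∣ X₁ ∣ ≡ d × ∣ X₂ ∣ ≡ d × X₁ ⊆ S₁ × X₂ ⊆ S₂
             × (∀ Y → (X₁ ⊆ Y × Y ⊆ ∁ X₂) ⊎ (X₂ ⊆ Y × Y ⊆ ∁ X₁)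
                  → IsMaximizer f Y))
lemma15 n d f f≤d posimodular f⊥≡0 maximal-shape =
  disjoint-maximizer , disjoint-maximizers-shrink
  where open MaximalMaximizers {f = f} posimodular f≤d f⊥≡0 maximal-shape
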